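{- Let $k\ge 1$ and let $M$ be a perfect matching of $[n]$ (drawn with $n$ points on the unit circle) having exactly $k$ crossings. If $M$ is connected, then $M$ coincides with its core, i.e. every chord of $M$ crosses at least one other chord of $M$; moreover $n_1(M)=n(M)\le 2(k+1)$ and $n_i(M)=0$ for all $i>1$.
   Context: Vertices $1,\dots,n$ are placed counterclockwise on the unit circle; a perfect matching of $[n]$ is drawn with straight chords. Two chords cross when their relative interiors intersect (chords $\{a,c\}$ and $\{b,d\}$ cross iff $a<b<c<d$ up to relabeling); the number of crossings is the number of crossing pairs of chords. The crossing graph of a matching has a vertex per chord and an edge between crossing chords; the matching is connected if its crossing graph is connected. The core of a matching is the submatching of chords involved in at least one crossing. $n(M)$ is the number of vertices of $M$. The regions of $M$ are the connected components of the complement in the closed unit disk of the union of its chords; a region has $i$ boundary arcs if its intersection with the unit circle consists of $i$ connected arcs; $n_i(M)$ is the number of regions with $i$ boundary arcs. -}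

module Defs where

open import Data.Nat using (ℕ; zero; suc; _+_; _<_; _≤_; _<?_; _≤?_; _≟_)
open import Data.Nat.Properties using ()
open import Data.Fin using (Fin; toℕ) renaming (zero to fzero; suc to fsuc)
open import Data.Fin.Properties using (all?; any?)
open import Data.Product using (Σ; ∃; _×_; _,_)
open import Data.Product.Relation.Unary.All using ()
open import Data.Sum using (_⊎_)
open import Relation.Binary.PropositionalEquality using (_≡_; _≢_)
open import Relation.Nullary using (Dec; yes; no; ¬_)
open import Relation.Nullary.Decidable using (_×-dec_; _⊎-dec_; _→-dec_)
open import Relation.Unary using (Pred; Decidable)
open import Relation.Binary.Construct.Closure.ReflexiveTransitive using (Star)

sumFin : ∀ {n} → (Fin n → ℕ) → ℕ
sumFin {zero} f = 0
sumFin {suc n} f = f fzero + sumFin {n} (λ i → f (fsuc i))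

count : ∀ {n} {P : Fin n → Set} → Decidable P → ℕ
count {zero} P? = 0
count {suc n} P? with P? fzero
... | yes _ = suc (count {n} (λ i → P? (fsuc i)))
... | no  _ = count {n} (λ i → P? (fsuc i))

-- A perfect matching of [n] = {0,…,n-1} (vertices in counterclockwise order),
-- given as a fixed-point-free involution: vertex i is matched to μ i.
record PerfectMatching (n : ℕ) : Set where
  field
    μ      : Fin n → Fin n
    invol  : ∀ i → μ (μ i) ≡ i
    noFix  : ∀ i → μ i ≢ i

module _ {n : ℕ} (M : PerfectMatching n) where
  open PerfectMatching M

  lo hi : Fin n → ℕ
  lo i with toℕ i ≤? toℕ (μ i)
  ... | yes _ = toℕ i
  ... | no  _ = toℕ (μ i)
  hi i with toℕ i ≤? toℕ (μ i)
  ... | yes _ = toℕ (μ i)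
  ... | no  _ = toℕ i

  -- chord through i crosses chord through j  ({a,c},{b,d} cross iff a<b<c<d up to relabeling)
  Crosses : Fin n → Fin n → Set
  Crosses i j = (lo i < lo j × lo j < hi i × hi i < hi j)
              ⊎ (lo j < lo i × lo i < hi j × hi j < hi i)

  -- crossing pairs of chords, each counted once: chords {a,c},{b,d} with a<b<c<d
  CrossPair : Fin n → Fin n → Set
  CrossPair a b = toℕ a < toℕ (μ a) × toℕ b < toℕ (μ b)
                × toℕ a < toℕ b × toℕ b < toℕ (μ a) × toℕ (μ a) < toℕ (μ b)

  CrossPair? : ∀ a b → Dec (CrossPair a b)
  CrossPair? a b = (toℕ a <? toℕ (μ a)) ×-dec ((toℕ b <? toℕ (μ b))
                 ×-dec ((toℕ a <? toℕ b) ×-dec ((toℕ b <? toℕ (μ a))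
                 ×-dec (toℕ (μ a) <? toℕ (μ b)))))

  crossings : ℕ
  crossings = sumFin {n} (λ a → count (CrossPair? a))

  -- the crossing graph (vertices = chords, represented by either endpoint)
  -- is connected: any two endpoints are linked by a chain of steps, each step
  -- either moving along a crossing or to the other endpoint of the same chord
  CrossOrSame : Fin n → Fin n → Set
  CrossOrSame i j = Crosses i j ⊎ j ≡ μ i

  Connected : Set
  Connected = ∀ i j → Star CrossOrSame i j

  EqualsCore : Set
  EqualsCore = ∀ i → ∃ λ j → Crosses i j

  -- Boundary gap g (g : Fin n) is the open arc of the circle between
  -- vertex g and vertex g+1 (mod n).  The chord through i, with endpoints
  -- lo i < hi i, has gaps lo i, …, hi i - 1 on one side and the rest on the other.
  Inside : Fin n → Fin n → Set
  Inside i g = lo i ≤ toℕ g × toℕ g < hi i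

  Inside? : ∀ i g → Dec (Inside i g)
  Inside? i g = (lo i ≤? toℕ g) ×-dec (toℕ g <? hi i)

  -- gaps g and h bound the same region iff no chord separates them
  SameRegion : Fin n → Fin n → Set
  SameRegion g h = ∀ i → (Inside i g → Inside i h) × (Inside i h → Inside i g)

  SameRegion? : ∀ g h → Dec (SameRegion g h)
  SameRegion? g h = all? (λ i → (Inside? i g →-dec Inside? i h) ×-dec (Inside? i h →-dec Inside? i g))

  arcsOfRegion : Fin n → ℕ
  arcsOfRegion g = count (SameRegion? g)

  -- g is the smallest gap of its region (one representative per region)
  IsRep : Fin n → Set
  IsRep g = ∀ h → SameRegion g h → toℕ g ≤ toℕ h

  IsRep? : ∀ g → Dec (IsRep g)
  IsRep? g = all? (λ h → SameRegion? g h →-dec (toℕ g ≤? toℕ h))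

  nArcs : ℕ → ℕ
  nArcs i = count (λ g → IsRep? g ×-dec (arcsOfRegion g ≟ i))

-- Every chord crosses another: a path in the crossing graph from it to a different chord (one of a
-- crossing pair) must begin with a crossing.  For the bound, give every chord
-- its breadth-first depth from the chord through vertex 0; sending each other chord to its crossing
-- with a parent of smaller depth is an injection into the crossings, so there are at most k + 1
-- chords.  Finally, if two gaps g < h bounded the same region, no chord would separate them, so the
-- chords with both ends in (g, h] would be closed under crossing; by connectivity they would
-- include the chord through h, hence the chord through g, which is absurd.  So every region has
-- exactly one boundary arc.
module Submission where

open import Defs
open import Data.Nat using (ℕ; zero; suc; _≤_; _<_; _+_; _*_; _⊓_; _⊔_; z≤n; s≤s; z<s; _<?_; _≤?_; _≟_)
open import Data.Nat.Properties
open import Data.Fin using (Fin; toℕ) renaming (zero to fzero; suc to fsuc)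
open import Data.Fin.Properties using (toℕ-injective; any?)
  renaming (0≢1+n to fzero≢fsuc; _≟_ to _≟ᶠ_; suc-injective to fsuc-injective)
open import Data.Product using (_×_; _,_; proj₁; proj₂; Σ; ∃; ∃₂; uncurry; swap)
open import Data.Product.Properties using (≡-dec)
open import Data.Sum using (_⊎_; inj₁; inj₂)
open import Data.Empty using (⊥; ⊥-elim)
open import Function using (id; _∘_; flip)
open import Relation.Binary using (tri<; tri≈; tri>)
open import Relation.Binary.PropositionalEquality
open import Relation.Binary.Construct.Closure.ReflexiveTransitive using (Star; ε; _◅_)
open import Relation.Nullary using (Dec; yes; no; ¬_; ¬?)
open import Relation.Nullary.Decidable using (_×-dec_; _⊎-dec_)
open import Relation.Unary using (Decidable)

count-cong : ∀ {n} {P Q : Fin n → Set} (P? : Decidable P) (Q? : Decidable Q) →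
             (∀ x → P x → Q x) → (∀ x → Q x → P x) → count P? ≡ count Q?
count-cong {zero}  _  _  _   _   = refl
count-cong {suc n} P? Q? P⇒Q Q⇒P with P? fzero | Q? fzero
... | yes _ | yes _  = cong suc (count-cong (P? ∘ fsuc) (Q? ∘ fsuc) (P⇒Q ∘ fsuc) (Q⇒P ∘ fsuc))
... | yes p | no ¬q  = ⊥-elim (¬q (P⇒Q fzero p))
... | no ¬p | yes q  = ⊥-elim (¬p (Q⇒P fzero q))
... | no _  | no _   = count-cong (P? ∘ fsuc) (Q? ∘ fsuc) (P⇒Q ∘ fsuc) (Q⇒P ∘ fsuc)

count-all : ∀ {n} {P : Fin n → Set} (P? : Decidable P) → (∀ x → P x) → count P? ≡ n
count-all {zero}  _  _   = refl
count-all {suc n} P? all with P? fzero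
... | yes _ = cong suc (count-all (P? ∘ fsuc) (all ∘ fsuc))
... | no ¬p = ⊥-elim (¬p (all fzero))

count-none : ∀ {n} {P : Fin n → Set} (P? : Decidable P) → (∀ x → ¬ P x) → count P? ≡ 0
count-none {zero}  _  _    = refl
count-none {suc n} P? none with P? fzero
... | yes p = ⊥-elim (none fzero p)
... | no _  = count-none (P? ∘ fsuc) (none ∘ fsuc)

count-complement : ∀ {n} {P : Fin n → Set} (P? : Decidable P) → count P? + count (¬? ∘ P?) ≡ n
count-complement {zero}  _  = refl
count-complement {suc n} P? with P? fzero
... | yes _ = cong suc (count-complement (P? ∘ fsuc))
... | no _  = trans (+-suc _ _) (cong suc (count-complement (P? ∘ fsuc)))

count-witness : ∀ {n} {P : Fin n → Set} (P? : Decidable P) → 0 < count P? → ∃ P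
count-witness {suc n} P? pos with P? fzero
... | yes p = fzero , p
... | no _  with count-witness (P? ∘ fsuc) pos
...   | x , px = fsuc x , px

count-remove : ∀ {n} {Q R : Fin n → Set} (Q? : Decidable Q) (R? : Decidable R) (y : Fin n) → Q y →
               (∀ x → R x → Q x × x ≢ y) → (∀ x → Q x → x ≢ y → R x) →
               count Q? ≡ suc (count R?)
count-remove {suc n} Q? R? fzero qy R⇒Q Q⇒R with Q? fzero | R? fzero
... | no ¬q | _     = ⊥-elim (¬q qy)
... | yes _ | yes r = ⊥-elim (proj₂ (R⇒Q fzero r) refl)
... | yes _ | no _  = cong suc (count-cong (Q? ∘ fsuc) (R? ∘ fsuc)
                        (λ x q → Q⇒R (fsuc x) q λ ()) (λ x r → proj₁ (R⇒Q (fsuc x) r)))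
count-remove {suc n} Q? R? (fsuc y) qy R⇒Q Q⇒R
  with count-remove (Q? ∘ fsuc) (R? ∘ fsuc) y qy
         (λ x r → proj₁ (R⇒Q (fsuc x) r) , proj₂ (R⇒Q (fsuc x) r) ∘ cong fsuc)
         (λ x q x≢y → Q⇒R (fsuc x) q (x≢y ∘ fsuc-injective))
     | Q? fzero | R? fzero
... | tail | yes _ | yes _ = cong suc tail
... | _    | yes q | no ¬r = ⊥-elim (¬r (Q⇒R fzero q λ ()))
... | _    | no ¬q | yes r = ⊥-elim (¬q (proj₁ (R⇒Q fzero r)))
... | tail | no _  | no _  = tail

count-unique : ∀ {n} {P : Fin n → Set} (P? : Decidable P) (y : Fin n) → P y →
               (∀ x → P x → x ≡ y) → count P? ≡ 1
count-unique P? y py unique = begin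
  count P?            ≡⟨ count-remove P? ⊥? y py (λ _ ()) (λ x px x≢y → x≢y (unique x px)) ⟩
  suc (count ⊥?)      ≡⟨ cong suc (count-none ⊥? λ _ ()) ⟩
  1                   ∎
  where
  open ≡-Reasoning
  ⊥? : Decidable {A = Fin _} λ _ → ⊥
  ⊥? _ = no id

sumFin-cong : ∀ {n} (f g : Fin n → ℕ) → (∀ a → f a ≡ g a) → sumFin f ≡ sumFin g
sumFin-cong {zero}  f g f≗g = refl
sumFin-cong {suc n} f g f≗g = cong₂ _+_ (f≗g fzero) (sumFin-cong (f ∘ fsuc) (g ∘ fsuc) (f≗g ∘ fsuc))

sumFin-witness : ∀ {n} (f : Fin n → ℕ) → 0 < sumFin f → ∃ λ a → 0 < f a
sumFin-witness {suc n} f pos with f fzero in eq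
... | suc _ = fzero , subst (0 <_) (sym eq) z<s
... | zero  with sumFin-witness (f ∘ fsuc) pos
...   | a , pos-a = fsuc a , pos-a

sumFin-suc : ∀ {n} (f g : Fin n → ℕ) (a₀ : Fin n) → f a₀ ≡ suc (g a₀) →
             (∀ a → a ≢ a₀ → f a ≡ g a) → sumFin f ≡ suc (sumFin g)
sumFin-suc {suc n} f g fzero f≡suc-g rest =
  cong₂ _+_ f≡suc-g (sumFin-cong (f ∘ fsuc) (g ∘ fsuc) λ a → rest (fsuc a) λ ())
sumFin-suc {suc n} f g (fsuc a₀) f≡suc-g rest = begin
  f fzero + sumFin (f ∘ fsuc)        ≡⟨ cong₂ _+_ (rest fzero λ ()) tail ⟩
  g fzero + suc (sumFin (g ∘ fsuc))  ≡⟨ +-suc _ _ ⟩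
  suc (sumFin g)                     ∎
  where
  open ≡-Reasoning
  tail = sumFin-suc (f ∘ fsuc) (g ∘ fsuc) a₀ f≡suc-g λ a a≢a₀ → rest (fsuc a) (a≢a₀ ∘ fsuc-injective)

sumFin-count-remove : ∀ {A B} {Q R : Fin A → Fin B → Set}
  (Q? : ∀ a → Decidable (Q a)) (R? : ∀ a → Decidable (R a)) (a₀ : Fin A) (b₀ : Fin B) → Q a₀ b₀ →
  (∀ a b → R a b → Q a b × (a , b) ≢ (a₀ , b₀)) → (∀ a b → Q a b → (a , b) ≢ (a₀ , b₀) → R a b) →
  sumFin (λ a → count (Q? a)) ≡ suc (sumFin (λ a → count (R? a)))
sumFin-count-remove Q? R? a₀ b₀ q₀ R⇒Q Q⇒R = sumFin-suc _ _ a₀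
  (count-remove (Q? a₀) (R? a₀) b₀ q₀
     (λ b r → proj₁ (R⇒Q a₀ b r) , λ b≡b₀ → proj₂ (R⇒Q a₀ b r) (cong (a₀ ,_) b≡b₀))
     (λ b q b≢b₀ → Q⇒R a₀ b q (b≢b₀ ∘ cong proj₂)))
  (λ a a≢a₀ → count-cong (Q? a) (R? a)
     (λ b q → Q⇒R a b q (a≢a₀ ∘ cong proj₁)) (λ b r → proj₁ (R⇒Q a b r)))

count≤sumFin-injection : ∀ {n A B} {P : Fin n → Set} {Q : Fin A → Fin B → Set}
  (P? : Decidable P) (Q? : ∀ a → Decidable (Q a)) (f : ∀ x → P x → Fin A × Fin B) →
  (∀ x px → uncurry Q (f x px)) → (∀ x y px py → f x px ≡ f y py → x ≡ y) →
  count P? ≤ sumFin (λ a → count (Q? a))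
count≤sumFin-injection {zero} _ _ _ _ _ = z≤n
count≤sumFin-injection {suc n} {A} {B} {Q = Q} P? Q? f f∈Q f-inj with P? fzero
... | no _  = count≤sumFin-injection (P? ∘ fsuc) Q? (f ∘ fsuc) (f∈Q ∘ fsuc)
                λ x y px py → fsuc-injective ∘ f-inj (fsuc x) (fsuc y) px py
... | yes p = begin
  suc (count (P? ∘ fsuc))            ≤⟨ s≤s (count≤sumFin-injection (P? ∘ fsuc) R? (f ∘ fsuc) f∈R
                                           λ x y px py → fsuc-injective ∘ f-inj (fsuc x) (fsuc y) px py) ⟩
  suc (sumFin (λ a → count (R? a)))  ≡⟨ sumFin-count-remove Q? R? _ _ (f∈Q fzero p) (λ _ _ r → r) (λ _ _ → _,_) ⟨
  sumFin (λ a → count (Q? a))        ∎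
  where
  open ≤-Reasoning
  R : Fin A → Fin B → Set
  R a b = Q a b × (a , b) ≢ f fzero p
  R? : ∀ a → Decidable (R a)
  R? a b = Q? a b ×-dec ¬? (≡-dec _≟ᶠ_ _≟ᶠ_ (a , b) (f fzero p))
  f∈R : ∀ x px → uncurry R (f (fsuc x) px)
  f∈R x px = f∈Q (fsuc x) px , λ fx≡f0 → fzero≢fsuc (sym (f-inj (fsuc x) fzero px p fx≡f0))

count≤count-injection : ∀ {n m} {P : Fin n → Set} {Q : Fin m → Set}
  (P? : Decidable P) (Q? : Decidable Q) (f : ∀ x → P x → Fin m) →
  (∀ x px → Q (f x px)) → (∀ x y px py → f x px ≡ f y py → x ≡ y) → count P? ≤ count Q?
count≤count-injection P? Q? f f∈Q f-inj = subst (count P? ≤_) (+-identityʳ _)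
  (count≤sumFin-injection {A = 1} P? (λ _ → Q?) (λ x px → fzero , f x px) f∈Q
     λ x y px py → f-inj x y px py ∘ cong proj₂)

least-witness : ∀ {P : ℕ → Set} → (∀ k → Dec (P k)) → ∀ {N} → P N →
                Σ ℕ λ k → P k × (∀ j → P j → k ≤ j)
least-witness P? {zero} p = 0 , p , λ _ _ → z≤n
least-witness P? {suc N} p with P? 0
... | yes p₀ = 0 , p₀ , λ _ _ → z≤n
... | no ¬p₀ with least-witness (P? ∘ suc) p
...   | k , pk , least = suc k , pk , λ where
          zero    p₀ → ⊥-elim (¬p₀ p₀)
          (suc j) pj → s≤s (least j pj)

module Chords {n : ℕ} (M : PerfectMatching n) where
  open PerfectMatching M

  IsLeft : Fin n → Set
  IsLeft w = toℕ w < toℕ (μ w)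

  IsLeft? : Decidable IsLeft
  IsLeft? w = toℕ w <? toℕ (μ w)

  toℕ-μ≢ : ∀ w → toℕ (μ w) ≢ toℕ w
  toℕ-μ≢ w = noFix w ∘ toℕ-injective

  μ-injective : ∀ {x y} → μ x ≡ μ y → x ≡ y
  μ-injective {x} {y} μx≡μy = trans (sym (invol x)) (trans (cong μ μx≡μy) (invol y))

  ¬IsLeft⇒IsLeft-μ : ∀ w → ¬ IsLeft w → IsLeft (μ w)
  ¬IsLeft⇒IsLeft-μ w ¬left = subst (λ x → toℕ (μ w) < toℕ x) (sym (invol w))
                               (≤∧≢⇒< (≮⇒≥ ¬left) (toℕ-μ≢ w))

  lo≡⊓ : ∀ w → lo M w ≡ toℕ w ⊓ toℕ (μ w)
  lo≡⊓ w with toℕ w ≤? toℕ (μ w)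
  ... | yes w≤μw = sym (m≤n⇒m⊓n≡m w≤μw)
  ... | no  w≰μw = sym (m≥n⇒m⊓n≡n (<⇒≤ (≰⇒> w≰μw)))

  hi≡⊔ : ∀ w → hi M w ≡ toℕ w ⊔ toℕ (μ w)
  hi≡⊔ w with toℕ w ≤? toℕ (μ w)
  ... | yes w≤μw = sym (m≤n⇒m⊔n≡n w≤μw)
  ... | no  w≰μw = sym (m≥n⇒m⊔n≡m (<⇒≤ (≰⇒> w≰μw)))

  lo-μ : ∀ w → lo M (μ w) ≡ lo M w
  lo-μ w = begin
    lo M (μ w)                 ≡⟨ lo≡⊓ (μ w) ⟩
    toℕ (μ w) ⊓ toℕ (μ (μ w))  ≡⟨ cong (λ x → toℕ (μ w) ⊓ toℕ x) (invol w) ⟩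
    toℕ (μ w) ⊓ toℕ w          ≡⟨ ⊓-comm (toℕ (μ w)) (toℕ w) ⟩
    toℕ w ⊓ toℕ (μ w)          ≡⟨ lo≡⊓ w ⟨
    lo M w                     ∎
    where open ≡-Reasoning

  hi-μ : ∀ w → hi M (μ w) ≡ hi M w
  hi-μ w = begin
    hi M (μ w)                 ≡⟨ hi≡⊔ (μ w) ⟩
    toℕ (μ w) ⊔ toℕ (μ (μ w))  ≡⟨ cong (λ x → toℕ (μ w) ⊔ toℕ x) (invol w) ⟩
    toℕ (μ w) ⊔ toℕ w          ≡⟨ ⊔-comm (toℕ (μ w)) (toℕ w) ⟩
    toℕ w ⊔ toℕ (μ w)          ≡⟨ hi≡⊔ w ⟨
    hi M w                     ∎
    where open ≡-Reasoning

  lo≤toℕ : ∀ w → lo M w ≤ toℕ w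
  lo≤toℕ w = subst (_≤ toℕ w) (sym (lo≡⊓ w)) (m⊓n≤m (toℕ w) (toℕ (μ w)))

  toℕ≡lo⊎hi : ∀ w → toℕ w ≡ lo M w ⊎ toℕ w ≡ hi M w
  toℕ≡lo⊎hi w with toℕ w ≤? toℕ (μ w)
  ... | yes _ = inj₁ refl
  ... | no  _ = inj₂ refl

  IsLeft⇒lo,hi : ∀ {w} → IsLeft w → lo M w ≡ toℕ w × hi M w ≡ toℕ (μ w)
  IsLeft⇒lo,hi {w} left with toℕ w ≤? toℕ (μ w)
  ... | yes _    = refl , refl
  ... | no  w≰μw = ⊥-elim (w≰μw (<⇒≤ left))

  leftEnd : ∀ u → Σ (Fin n) λ u′ → IsLeft u′ × (u′ ≡ u ⊎ u′ ≡ μ u)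
  leftEnd u with IsLeft? u
  ... | yes left = u , left , inj₁ refl
  ... | no ¬left = μ u , ¬IsLeft⇒IsLeft-μ u ¬left , inj₂ refl

  Crosses? : ∀ v w → Dec (Crosses M v w)
  Crosses? v w = ((lo M v <? lo M w) ×-dec ((lo M w <? hi M v) ×-dec (hi M v <? hi M w)))
          ⊎-dec ((lo M w <? lo M v) ×-dec ((lo M v <? hi M w) ×-dec (hi M w <? hi M v)))

  Crosses-μˡ : ∀ v w → Crosses M v w → Crosses M (μ v) w
  Crosses-μˡ v w = subst₂ (λ l h → (l < lo M w × lo M w < h × h < hi M w)
                                      ⊎ (lo M w < l × l < hi M w × hi M w < h))
                              (sym (lo-μ v)) (sym (hi-μ v))

  Crosses-μʳ : ∀ v w → Crosses M v w → Crosses M v (μ w)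
  Crosses-μʳ v w = subst₂ (λ l h → (lo M v < l × l < hi M v × hi M v < h)
                                      ⊎ (l < lo M v × lo M v < h × h < hi M v))
                              (sym (lo-μ w)) (sym (hi-μ w))

  Crosses⇒CrossPair : ∀ {u v} → IsLeft u → IsLeft v → Crosses M u v → CrossPair M u v ⊎ CrossPair M v u
  Crosses⇒CrossPair {u} {v} lu lv uv
    with lo M u | hi M u | lo M v | hi M v | IsLeft⇒lo,hi lu | IsLeft⇒lo,hi lv | uv
  ... | _ | _ | _ | _ | refl , refl | refl , refl | inj₁ u<v<u<v = inj₁ (lu , lv , u<v<u<v)
  ... | _ | _ | _ | _ | refl , refl | refl , refl | inj₂ v<u<v<u = inj₂ (lv , lu , v<u<v<u)

  Star⇒Crosses : ∀ {v w} → Star (CrossOrSame M) v w → lo M w ≢ lo M v → ∃ (Crosses M v)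
  Star⇒Crosses ε                              lo≢ = ⊥-elim (lo≢ refl)
  Star⇒Crosses (_◅_ {j = x} (inj₁ vx) _)      _   = x , vx
  Star⇒Crosses {v} (inj₂ refl ◅ path)         lo≢ with Star⇒Crosses path (lo≢ ∘ flip trans (lo-μ v))
  ... | x , μv-x = x , subst (λ y → Crosses M y x) (invol v) (Crosses-μˡ (μ v) x μv-x)

  CrossPair⇒lo< : ∀ {a b} → CrossPair M a b → lo M a < lo M b
  CrossPair⇒lo< {a} {b} (la , lb , a<b , _)
    with lo M a | lo M b | proj₁ (IsLeft⇒lo,hi la) | proj₁ (IsLeft⇒lo,hi lb)
  ... | _ | _ | refl | refl = a<b

  crossing-witness : 0 < crossings M → ∃₂ (CrossPair M)
  crossing-witness pos with a , pos-a ← sumFin-witness _ pos = a , count-witness (CrossPair? M a) pos-a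

  connected⇒EqualsCore : 0 < crossings M → Connected M → EqualsCore M
  connected⇒EqualsCore pos conn i
    with a , b , ab ← crossing-witness pos
    with lo M i ≟ lo M a
  ... | yes i≈a = Star⇒Crosses (conn i b) λ b≈i → <⇒≢ (CrossPair⇒lo< ab) (sym (trans b≈i i≈a))
  ... | no  i≉a = Star⇒Crosses (conn i a) (i≉a ∘ sym)

  vertices≤2*lefts : n ≤ 2 * count IsLeft?
  vertices≤2*lefts = begin
    n                                        ≡⟨ count-complement IsLeft? ⟨
    count IsLeft? + count (¬? ∘ IsLeft?)     ≤⟨ +-monoʳ-≤ (count IsLeft?) rights≤lefts ⟩
    count IsLeft? + count IsLeft?            ≡⟨ cong (count IsLeft? +_) (+-identityʳ _) ⟨
    2 * count IsLeft?                        ∎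
    where
    open ≤-Reasoning
    rights≤lefts : count (¬? ∘ IsLeft?) ≤ count IsLeft?
    rights≤lefts = count≤count-injection (¬? ∘ IsLeft?) IsLeft? (λ w _ → μ w) ¬IsLeft⇒IsLeft-μ
                     λ _ _ _ _ → μ-injective

module SpanningTree {n : ℕ} (M : PerfectMatching (suc n)) (conn : Connected M) where
  open PerfectMatching M
  open Chords M

  -- The root is the chord through vertex 0, the one with lo = 0.
  Reach : ℕ → Fin (suc n) → Set
  Reach zero    v = lo M v ≡ 0
  Reach (suc k) v = Reach k v ⊎ ∃ λ u → Reach k u × Crosses M u v

  Reach? : ∀ k → Decidable (Reach k)
  Reach? zero    v = lo M v ≟ 0
  Reach? (suc k) v = Reach? k v ⊎-dec any? (λ u → Reach? k u ×-dec Crosses? u v)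

  Reach-μ : ∀ k {v} → Reach k v → Reach k (μ v)
  Reach-μ zero    {v} r                  = trans (lo-μ v) r
  Reach-μ (suc k)     (inj₁ r)           = inj₁ (Reach-μ k r)
  Reach-μ (suc k) {v} (inj₂ (u , r , c)) = inj₂ (u , r , Crosses-μʳ u v c)

  Reach-Star : ∀ k {v w} → Reach k v → Star (CrossOrSame M) v w → ∃ λ k′ → Reach k′ w
  Reach-Star k     r ε                  = k , r
  Reach-Star k {v} r (inj₁ vx ◅ path)   = Reach-Star (suc k) (inj₂ (v , r , vx)) path
  Reach-Star k     r (inj₂ refl ◅ path) = Reach-Star k (Reach-μ k r) path

  shortest : ∀ v → Σ ℕ λ k → Reach k v × (∀ j → Reach j v → k ≤ j)
  shortest v = least-witness (λ k → Reach? k v) (proj₂ (Reach-Star 0 (lo≡⊓ fzero) (conn fzero v)))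

  depth : Fin (suc n) → ℕ
  depth v = proj₁ (shortest v)

  depth-Reach : ∀ v → Reach (depth v) v
  depth-Reach v = proj₁ (proj₂ (shortest v))

  depth-minimal : ∀ v j → Reach j v → depth v ≤ j
  depth-minimal v = proj₂ (proj₂ (shortest v))

  Parent : Fin (suc n) → ℕ → Set
  Parent v m = Σ (Fin (suc n)) λ u → IsLeft u × Crosses M u v × depth u < m

  parent-below : ∀ {v} m → lo M v ≢ 0 → Reach m v → (∀ j → Reach j v → m ≤ j) → Parent v m
  parent-below zero    lo≢0 r                  _       = ⊥-elim (lo≢0 r)
  parent-below (suc m) _    (inj₁ r)           minimal = ⊥-elim (1+n≰n (minimal m r))
  parent-below {v} (suc m) _ (inj₂ (u , r , c)) _ with leftEnd u
  ... | _ , left , inj₁ refl = u   , left , c , s≤s (depth-minimal u m r)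
  ... | _ , left , inj₂ refl = μ u , left , Crosses-μˡ u v c , s≤s (depth-minimal (μ u) m (Reach-μ m r))

  NonRoot : Fin (suc n) → Set
  NonRoot v = IsLeft v × v ≢ fzero

  NonRoot? : Decidable NonRoot
  NonRoot? v = IsLeft? v ×-dec ¬? (v ≟ᶠ fzero)

  parent : ∀ {v} → NonRoot v → Parent v (depth v)
  parent {v} (left , v≢0) = parent-below (depth v) lo≢0 (depth-Reach v) (depth-minimal v)
    where
    lo≢0 : lo M v ≢ 0
    lo≢0 lo≡0 = v≢0 (toℕ-injective (trans (sym (proj₁ (IsLeft⇒lo,hi left))) lo≡0))

  Oriented : Fin (suc n) → Fin (suc n) → Set
  Oriented u v = CrossPair M u v ⊎ CrossPair M v u

  orient : ∀ {u v} → Oriented u v → Fin (suc n) × Fin (suc n)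
  orient {u} {v} (inj₁ _) = u , v
  orient {u} {v} (inj₂ _) = v , u

  orient-CrossPair : ∀ {u v} (o : Oriented u v) → uncurry (CrossPair M) (orient o)
  orient-CrossPair (inj₁ uv) = uv
  orient-CrossPair (inj₂ vu) = vu

  orient-injective : ∀ {u v u′ v′} (o : Oriented u v) (o′ : Oriented u′ v′) →
                     depth u < depth v → depth u′ < depth v′ → orient o ≡ orient o′ → v ≡ v′
  orient-injective (inj₁ _) (inj₁ _) _ _ refl = refl
  orient-injective (inj₂ _) (inj₂ _) _ _ refl = refl
  orient-injective (inj₁ _) (inj₂ _) u<v u′<v′ refl = ⊥-elim (<-asym u<v u′<v′)
  orient-injective (inj₂ _) (inj₁ _) u<v u′<v′ refl = ⊥-elim (<-asym u<v u′<v′)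

  treeEdge : ∀ {v} (nr : NonRoot v) → Oriented (proj₁ (parent nr)) v
  treeEdge {v} nr with parent nr
  ... | _ , left-u , uv , _ = Crosses⇒CrossPair left-u (proj₁ nr) uv

  parent-shallower : ∀ {v} (nr : NonRoot v) → depth (proj₁ (parent nr)) < depth v
  parent-shallower nr = proj₂ (proj₂ (proj₂ (parent nr)))

  nonRoots≤crossings : count NonRoot? ≤ crossings M
  nonRoots≤crossings = count≤sumFin-injection NonRoot? (CrossPair? M)
    (λ _ → orient ∘ treeEdge) (λ _ → orient-CrossPair ∘ treeEdge)
    λ _ _ nx ny → orient-injective (treeEdge nx) (treeEdge ny) (parent-shallower nx) (parent-shallower ny)

  lefts≤crossings+1 : count IsLeft? ≤ crossings M + 1
  lefts≤crossings+1 = begin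
    count IsLeft?          ≡⟨ count-remove IsLeft? NonRoot? fzero (n≢0⇒n>0 (toℕ-μ≢ fzero))
                                               (λ _ → id) (λ _ → _,_) ⟩
    suc (count NonRoot?)   ≤⟨ s≤s nonRoots≤crossings ⟩
    suc (crossings M)      ≡⟨ +-comm 1 (crossings M) ⟩
    crossings M + 1        ∎
    where open ≤-Reasoning

vertices≤2[crossings+1] : ∀ {n} (M : PerfectMatching n) → Connected M → n ≤ 2 * (crossings M + 1)
vertices≤2[crossings+1] {zero}  M conn = z≤n
vertices≤2[crossings+1] {suc n} M conn =
  ≤-trans (vertices≤2*lefts) (*-monoʳ-≤ 2 (lefts≤crossings+1))
  where
  open Chords M
  open SpanningTree M conn

-- Gap g lies between vertices g and g + 1, so for g < h the vertices between gaps g and h are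
-- those in (g, h].
module Regions {n : ℕ} (M : PerfectMatching n) {g h : Fin n} (same : SameRegion M g h) where
  open PerfectMatching M
  open Chords M

  NestedIn : Fin n → Set
  NestedIn v = toℕ g < lo M v × hi M v ≤ toℕ h

  endpoint⇒NestedIn : ∀ w → (toℕ g < lo M w × lo M w ≤ toℕ h) ⊎ (toℕ g < hi M w × hi M w ≤ toℕ h) →
                      NestedIn w
  endpoint⇒NestedIn w (inj₁ (g<lo , lo≤h)) =
    g<lo , ≮⇒≥ λ h<hi → <⇒≱ g<lo (proj₁ (proj₂ (same w) (lo≤h , h<hi)))
  endpoint⇒NestedIn w (inj₂ (g<hi , hi≤h)) =
    (≰⇒> λ lo≤g → <⇒≱ (proj₂ (proj₁ (same w) (lo≤g , g<hi))) hi≤h) , hi≤h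

  NestedIn-μ : ∀ {v} → NestedIn v → NestedIn (μ v)
  NestedIn-μ {v} (g<lo , hi≤h) =
    subst (toℕ g <_) (sym (lo-μ v)) g<lo , subst (_≤ toℕ h) (sym (hi-μ v)) hi≤h

  NestedIn-Crosses : ∀ v w → NestedIn v → Crosses M v w → NestedIn w
  NestedIn-Crosses v w (g<lo , hi≤h) (inj₁ (lo<lo , lo<hi , _)) =
    endpoint⇒NestedIn w (inj₁ (<-trans g<lo lo<lo , <⇒≤ (<-≤-trans lo<hi hi≤h)))
  NestedIn-Crosses v w (g<lo , hi≤h) (inj₂ (_ , lo<hi , hi<hi)) =
    endpoint⇒NestedIn w (inj₂ (<-trans g<lo lo<hi , <⇒≤ (<-≤-trans hi<hi hi≤h)))

  NestedIn-Star : ∀ {v w} → Star (CrossOrSame M) v w → NestedIn v → NestedIn w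
  NestedIn-Star ε                                  nested = nested
  NestedIn-Star {v} (_◅_ {j = x} (inj₁ vx) path)   nested = NestedIn-Star path (NestedIn-Crosses v x nested vx)
  NestedIn-Star (inj₂ refl ◅ path)                 nested = NestedIn-Star path (NestedIn-μ nested)

  ¬NestedIn-g : ¬ NestedIn g
  ¬NestedIn-g (g<lo , _) = <⇒≱ g<lo (lo≤toℕ g)

  NestedIn-h : toℕ g < toℕ h → NestedIn h
  NestedIn-h g<h with toℕ≡lo⊎hi h
  ... | inj₁ h≡lo = endpoint⇒NestedIn h (inj₁ (subst (toℕ g <_) h≡lo g<h , ≤-reflexive (sym h≡lo)))
  ... | inj₂ h≡hi = endpoint⇒NestedIn h (inj₂ (subst (toℕ g <_) h≡hi g<h , ≤-reflexive (sym h≡hi)))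

  connected⇒¬g<h : Connected M → ¬ toℕ g < toℕ h
  connected⇒¬g<h conn g<h = ¬NestedIn-g (NestedIn-Star (conn h g) (NestedIn-h g<h))

connected⇒SameRegion⇒≡ : ∀ {n} (M : PerfectMatching n) → Connected M →
                         ∀ {g h} → SameRegion M g h → g ≡ h
connected⇒SameRegion⇒≡ M conn {g} {h} same with <-cmp (toℕ g) (toℕ h)
... | tri< g<h _ _ = ⊥-elim (Regions.connected⇒¬g<h M same conn g<h)
... | tri≈ _ g≡h _ = toℕ-injective g≡h
... | tri> _ _ h<g = ⊥-elim (Regions.connected⇒¬g<h M (swap ∘ same) conn h<g)

arcsOfRegion≡1 : ∀ {n} (M : PerfectMatching n) → Connected M → ∀ g → arcsOfRegion M g ≡ 1
arcsOfRegion≡1 M conn g = count-unique (SameRegion? M g) g (λ _ → id , id)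
  λ h same → sym (connected⇒SameRegion⇒≡ M conn same)

connected⇒IsRep : ∀ {n} (M : PerfectMatching n) → Connected M → ∀ g → IsRep M g
connected⇒IsRep M conn g h same = ≤-reflexive (cong toℕ (connected⇒SameRegion⇒≡ M conn same))

nArcs1≡n : ∀ {n} (M : PerfectMatching n) → Connected M → nArcs M 1 ≡ n
nArcs1≡n M conn = count-all (λ g → IsRep? M g ×-dec (arcsOfRegion M g ≟ 1))
  λ g → connected⇒IsRep M conn g , arcsOfRegion≡1 M conn g

nArcs>1≡0 : ∀ {n} (M : PerfectMatching n) → Connected M → ∀ i → 1 < i → nArcs M i ≡ 0
nArcs>1≡0 M conn i 1<i = count-none (λ g → IsRep? M g ×-dec (arcsOfRegion M g ≟ i))
  λ g (_ , arcs≡i) → <⇒≢ 1<i (trans (sym (arcsOfRegion≡1 M conn g)) arcs≡i)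

lemma2p8 : ∀ (n k : ℕ) (M : PerfectMatching n) → 1 ≤ k → crossings M ≡ k → Connected M →
    EqualsCore M × nArcs M 1 ≡ n × n ≤ 2 * (k + 1) × (∀ i → 1 < i → nArcs M i ≡ 0)
lemma2p8 n k M 1≤k refl conn =
    Chords.connected⇒EqualsCore M 1≤k conn
  , nArcs1≡n M conn
  , vertices≤2[crossings+1] M conn
  , nArcs>1≡0 M conn
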